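{- Let $n\geq 4$ and let $C_n$ be the cycle on $n$ vertices. Then $\operatorname{zir}(C_n)=\operatorname{Z}(C_n)=\overline{\operatorname{Z}}(C_n)=2$ and $\operatorname{ZIR}(C_n)=\lfloor n/2\rfloor$.
   Context: All graphs are simple, undirected, finite. Zero forcing: from a set $B$ of blue vertices, a blue vertex $u$ may turn a white vertex $w$ blue if $w$ is the only white neighbor of $u$; $B$ is a zero forcing set if eventually all vertices are blue. $\operatorname{Z}(G)$ is the minimum size of a zero forcing set; $\overline{\operatorname{Z}}(G)$ is the maximum size of an inclusion-minimal zero forcing set. A fort is a nonempty $F\subseteq V(G)$ such that every $v\notin F$ has $|F\cap N(v)|\neq 1$. For $S\subseteq V(G)$, $x\in S$, a private fort of $x$ relative to $S$ is a fort $F$ with $S\cap F=\{x\}$; $S$ is a ZIr-set if every element has a private fort. $\operatorname{zir}(G)$ and $\operatorname{ZIR}(G)$ are the minimum and maximum cardinality of an inclusion-maximal ZIr-set of $G$. -}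

module Defs where

open import Data.Nat using (ℕ; zero; suc; _≤_; _≥_; _∸_)
open import Data.Bool using (Bool; true; false; _∨_; if_then_else_)
open import Data.Fin using (Fin; toℕ)
open import Data.Fin.Subset using (Subset; inside; outside; _∈_; _∉_; _⊂_; _∩_; _∪_; ⁅_⁆; ∣_∣; ⊤; Nonempty)
open import Data.Vec using (tabulate)
open import Data.Product using (Σ; ∃; _×_; _,_)
open import Relation.Binary.PropositionalEquality using (_≡_; _≢_)
open import Relation.Binary.Construct.Closure.ReflexiveTransitive using (Star)
open import Relation.Nullary using (¬_)
open import Relation.Nullary.Decidable using (⌊_⌋)
import Data.Nat as ℕ

record Graph (n : ℕ) : Set where
  field
    adj     : Fin n → Fin n → Bool
    adj-sym : ∀ u v → adj u v ≡ adj v u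
    adj-irr : ∀ v → adj v v ≡ false
open Graph public

N : ∀ {n} → Graph n → Fin n → Subset n
N G v = tabulate (λ w → if adj G v w then inside else outside)

-- One zero forcing step: blue u forces its unique white neighbour w.
data Force {n} (G : Graph n) : Subset n → Subset n → Set where
  force : ∀ {B} (u w : Fin n) →
          u ∈ B → w ∉ B → adj G u w ≡ true →
          (∀ v → adj G u v ≡ true → v ≢ w → v ∈ B) →
          Force G B (B ∪ ⁅ w ⁆)

ZFS : ∀ {n} → Graph n → Subset n → Set
ZFS G B = Star (Force G) B ⊤

MinimalZFS : ∀ {n} → Graph n → Subset n → Set
MinimalZFS G B = ZFS G B × (∀ C → C ⊂ B → ¬ ZFS G C)

Fort : ∀ {n} → Graph n → Subset n → Set
Fort G F = Nonempty F × (∀ v → v ∉ F → ∣ F ∩ N G v ∣ ≢ 1)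

PrivateFort : ∀ {n} → Graph n → Subset n → Fin n → Subset n → Set
PrivateFort G S x F = Fort G F × (S ∩ F ≡ ⁅ x ⁆)

ZIrSet : ∀ {n} → Graph n → Subset n → Set
ZIrSet G S = ∀ x → x ∈ S → ∃ λ F → PrivateFort G S x F

MaximalZIrSet : ∀ {n} → Graph n → Subset n → Set
MaximalZIrSet G S = ZIrSet G S × (∀ T → S ⊂ T → ¬ ZIrSet G T)

IsMinCard : ∀ {n} → (Subset n → Set) → ℕ → Set
IsMinCard P k = (∃ λ S → P S × ∣ S ∣ ≡ k) × (∀ S → P S → k ≤ ∣ S ∣)

IsMaxCard : ∀ {n} → (Subset n → Set) → ℕ → Set
IsMaxCard P k = (∃ λ S → P S × ∣ S ∣ ≡ k) × (∀ S → P S → ∣ S ∣ ≤ k)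

-- the graph parameters, as relations "parameter(G) = k"
Zeq : ∀ {n} → Graph n → ℕ → Set
Zeq G = IsMinCard (ZFS G)

Zbareq : ∀ {n} → Graph n → ℕ → Set
Zbareq G = IsMaxCard (MinimalZFS G)

zireq : ∀ {n} → Graph n → ℕ → Set
zireq G = IsMinCard (MaximalZIrSet G)

ZIReq : ∀ {n} → Graph n → ℕ → Set
ZIReq G = IsMaxCard (MaximalZIrSet G)

-- Cycle C_n on vertices 0..n-1: i ~ j iff j = i+1 or i = j+1 or {i,j} = {0,n-1}.
-- (simple for n ≥ 3)
cycAdj₀ : ∀ n → Fin n → Fin n → Bool
cycAdj₀ n i j = ⌊ toℕ j ℕ.≟ suc (toℕ i) ⌋ ∨ (⌊ toℕ i ℕ.≟ n ∸ 1 ⌋ Data.Bool.∧ ⌊ toℕ j ℕ.≟ 0 ⌋)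
  where import Data.Bool

cycAdj : ∀ n → Fin n → Fin n → Bool
cycAdj n i j = cycAdj₀ n i j ∨ cycAdj₀ n j i

private
  open import Data.Bool using (_∧_)
  open import Data.Bool.Properties using (∨-comm)
  open import Data.Nat.Properties using (<-irrefl; n<1+n)
  open import Relation.Nullary using (yes; no)
  open import Relation.Binary.PropositionalEquality using (refl; trans; sym)
  open import Data.Empty using (⊥-elim)

  cycAdj₀-irr : ∀ n → 3 ≤ n → ∀ i → cycAdj₀ n i i ≡ false
  cycAdj₀-irr n h i with toℕ i ℕ.≟ suc (toℕ i)
  ... | yes p = ⊥-elim (<-irrefl p (n<1+n _))
  ... | no _ with toℕ i ℕ.≟ n ∸ 1 | toℕ i ℕ.≟ 0
  ... | yes p | yes q = ⊥-elim (bad n h (trans (sym p) q))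
    where
      bad : ∀ n → 3 ≤ n → n ∸ 1 ≢ 0
      bad (suc (suc (suc _))) _ ()
      bad (suc zero) (ℕ.s≤s ()) _
  ... | yes _ | no _ = refl
  ... | no _ | _ = refl

  irr : ∀ n → 3 ≤ n → ∀ v → cycAdj n v v ≡ false
  irr n h v rewrite cycAdj₀-irr n h v = refl

Cycle : (n : ℕ) → 3 ≤ n → Graph n
Cycle n h = record
  { adj     = cycAdj n
  ; adj-sym = λ u v → ∨-comm (cycAdj₀ n u v) (cycAdj₀ n v u)
  ; adj-irr = irr n h
  }

-- The complement of a fort is closed under forcing, so every zero forcing set meets
-- every fort. A zero forcing set B inside a ZIr set S therefore contains all of S:
-- the private fort of x ∈ S meets S only in x. Conversely, if S - x is independent and
-- every vertex has two neighbours, then ∁ (S - x) is a private fort of x.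
--
-- In the cycle every edge is a zero forcing set (force once around the cycle) and every
-- zero forcing set contains an edge. Hence minimal zero forcing sets and maximal ZIr sets
-- containing an edge are edges, which gives Z = Z̄ = zir = 2, and a ZIr set with more than
-- two vertices is independent, which gives ZIR ≤ ⌊n/2⌋. The alternating set {0, 2, 4, …}
-- attains this: it is independent, and every vertex outside it has a neighbour in it, so
-- every proper superset contains an edge and more than two vertices.

module Submission where

open import Defs
open import Data.Bool using (true; false; _∨_; _∧_; if_then_else_)
open import Data.Empty using (⊥-elim)
open import Data.Fin using (Fin; zero; suc; toℕ; fromℕ<)
open import Data.Fin.Properties using (toℕ-injective; toℕ≤n; toℕ≤pred[n]; toℕ-fromℕ<)
import Data.Fin.Properties as Fin
open import Data.Fin.Subset
open import Data.Fin.Subset.Properties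
open import Data.Nat using (ℕ; zero; suc; _+_; _∸_; _≤_; _<_; _/_; ⌊_/2⌋; z≤n; s≤s; s≤s⁻¹)
open import Data.Nat.DivMod using (m/n≡1+[m∸n]/n; /-monoˡ-≤)
open import Data.Nat.Properties
open import Function using (_∘_; case_of_)
open import Data.Product using (∃; ∃₂; _×_; _,_; proj₁; proj₂)
open import Data.Sum using (_⊎_; inj₁; inj₂)
import Data.Sum as Sum
open import Data.Vec using (Vec; []; _∷_; _∷ʳ_; lookup; here; there)
open import Data.Vec.Properties using (lookup∘tabulate; []=⇒lookup; lookup⇒[]=)
open import Relation.Binary.Construct.Closure.ReflexiveTransitive using (ε; _◅_)
open import Relation.Binary.PropositionalEquality
open import Relation.Nullary using (¬_; Dec; yes; no; contradiction)
open import Relation.Nullary.Decidable using (⌊_⌋)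

private
  variable
    A : Set
    m n : ℕ
    p B B′ F S : Subset n
    u v w x y : Fin n

x∈p─q⇒x∉q : ∀ (p q : Subset n) → x ∈ p ─ q → x ∉ q
x∈p─q⇒x∉q (_ ∷ p) (outside ∷ q) (there x∈) (there x∈q) = x∈p─q⇒x∉q p q x∈ x∈q
x∈p─q⇒x∉q (_ ∷ p) (inside ∷ q)  (there x∈) (there x∈q) = x∈p─q⇒x∉q p q x∈ x∈q

x∉p-x : ∀ (p : Subset n) x → x ∉ p - x
x∉p-x p x x∈ = x∈p─q⇒x∉q p ⁅ x ⁆ x∈ (x∈⁅x⁆ x)

x∈p⇒0<∣p∣ : x ∈ p → 0 < ∣ p ∣
x∈p⇒0<∣p∣ {x = x} x∈p =
  subst (_≤ _) (∣⁅x⁆∣≡1 x) (p⊆q⇒∣p∣≤∣q∣ λ y∈ → subst (_∈ _) (sym (x∈⁅y⁆⇒x≡y x y∈)) x∈p)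

x∈p∧y∈p∧x≢y⇒2≤∣p∣ : x ∈ p → y ∈ p → x ≢ y → 2 ≤ ∣ p ∣
x∈p∧y∈p∧x≢y⇒2≤∣p∣ x∈p y∈p x≢y =
  <-≤-trans (s≤s (x∈p⇒0<∣p∣ (x∈p∧x≢y⇒x∈p-y y∈p (x≢y ∘ sym)))) (x∈p⇒∣p-x∣<∣p∣ x∈p)

∣p∣<2⇒x≡y : ∣ p ∣ < 2 → x ∈ p → y ∈ p → x ≡ y
∣p∣<2⇒x≡y {x = x} {y = y} ∣p∣<2 x∈p y∈p with x Fin.≟ y
... | yes x≡y = x≡y
... | no  x≢y = contradiction (x∈p∧y∈p∧x≢y⇒2≤∣p∣ x∈p y∈p x≢y) (<⇒≱ ∣p∣<2)

∣p∣<2∧x≢y⇒∃∉ : ∀ {p : Subset n} {x y : Fin n} → ∣ p ∣ < 2 → x ≢ y → ∃ λ z → z ∉ p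
∣p∣<2∧x≢y⇒∃∉ {p = p} {x = x} {y = y} ∣p∣<2 x≢y with x ∈? p | y ∈? p
... | no  x∉p | _       = x , x∉p
... | yes _   | no  y∉p = y , y∉p
... | yes x∈p | yes y∈p = contradiction (∣p∣<2⇒x≡y ∣p∣<2 x∈p y∈p) x≢y

∣p∪q∣≤∣p∣+∣q∣ : ∀ (p q : Subset n) → ∣ p ∪ q ∣ ≤ ∣ p ∣ + ∣ q ∣
∣p∪q∣≤∣p∣+∣q∣ []            []            = z≤n
∣p∪q∣≤∣p∣+∣q∣ (outside ∷ p) (outside ∷ q) = ∣p∪q∣≤∣p∣+∣q∣ p q
∣p∪q∣≤∣p∣+∣q∣ (inside ∷ p)  (outside ∷ q) = s≤s (∣p∪q∣≤∣p∣+∣q∣ p q)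
∣p∪q∣≤∣p∣+∣q∣ (outside ∷ p) (inside ∷ q)  =
  subst (∣ p ∪ q ∣ <_) (sym (+-suc ∣ p ∣ ∣ q ∣)) (s≤s (∣p∪q∣≤∣p∣+∣q∣ p q))
∣p∪q∣≤∣p∣+∣q∣ (inside ∷ p)  (inside ∷ q)  =
  s≤s (≤-trans (∣p∪q∣≤∣p∣+∣q∣ p q) (+-monoʳ-≤ ∣ p ∣ (n≤1+n ∣ q ∣)))

x∈p⇒p∪⁅x⁆≡p : x ∈ p → p ∪ ⁅ x ⁆ ≡ p
x∈p⇒p∪⁅x⁆≡p {x = x} {p = p} x∈p = ⊆-antisym p∪⁅x⁆⊆p (p⊆p∪q ⁅ x ⁆)
  where
  p∪⁅x⁆⊆p : p ∪ ⁅ x ⁆ ⊆ p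
  p∪⁅x⁆⊆p y∈ with x∈p∪q⁻ p ⁅ x ⁆ y∈
  ... | inj₁ y∈p   = y∈p
  ... | inj₂ y∈⁅x⁆ = subst (_∈ p) (sym (x∈⁅y⁆⇒x≡y x y∈⁅x⁆)) x∈p

x∈⁅y⁆∪⁅z⁆⇒x≡y∨x≡z : ∀ {z : Fin n} → x ∈ ⁅ y ⁆ ∪ ⁅ z ⁆ → x ≡ y ⊎ x ≡ z
x∈⁅y⁆∪⁅z⁆⇒x≡y∨x≡z {y = y} {z = z} x∈ with x∈p∪q⁻ ⁅ y ⁆ ⁅ z ⁆ x∈
... | inj₁ x∈⁅y⁆ = inj₁ (x∈⁅y⁆⇒x≡y y x∈⁅y⁆)
... | inj₂ x∈⁅z⁆ = inj₂ (x∈⁅y⁆⇒x≡y z x∈⁅z⁆)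

⁅x⁆∪⁅y⁆⊆p : x ∈ p → y ∈ p → ⁅ x ⁆ ∪ ⁅ y ⁆ ⊆ p
⁅x⁆∪⁅y⁆⊆p x∈p y∈p z∈ with x∈⁅y⁆∪⁅z⁆⇒x≡y∨x≡z z∈
... | inj₁ refl = x∈p
... | inj₂ refl = y∈p

∣⁅x⁆∪⁅y⁆∣≤2 : ∀ (x y : Fin n) → ∣ ⁅ x ⁆ ∪ ⁅ y ⁆ ∣ ≤ 2
∣⁅x⁆∪⁅y⁆∣≤2 x y =
  subst₂ (λ a b → ∣ ⁅ x ⁆ ∪ ⁅ y ⁆ ∣ ≤ a + b) (∣⁅x⁆∣≡1 x) (∣⁅x⁆∣≡1 y) (∣p∪q∣≤∣p∣+∣q∣ ⁅ x ⁆ ⁅ y ⁆)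

∣⁅x⁆∪⁅y⁆∣≡2 : x ≢ y → ∣ ⁅ x ⁆ ∪ ⁅ y ⁆ ∣ ≡ 2
∣⁅x⁆∪⁅y⁆∣≡2 {x = x} {y = y} x≢y = ≤-antisym (∣⁅x⁆∪⁅y⁆∣≤2 x y)
  (x∈p∧y∈p∧x≢y⇒2≤∣p∣ (x∈p∪q⁺ (inj₁ (x∈⁅x⁆ x))) (x∈p∪q⁺ (inj₂ (x∈⁅x⁆ y))) x≢y)

-- Forts, zero forcing sets and ZIr sets

Independent : Graph n → Subset n → Set
Independent G S = ∀ {u v} → u ∈ S → v ∈ S → adj G u v ≢ true

HasTwoNeighbours : Graph n → Set
HasTwoNeighbours G = ∀ v → ∃₂ λ a b → a ≢ b × adj G v a ≡ true × adj G v b ≡ true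

module _ {G : Graph n} where

  adj⇒≢ : adj G u v ≡ true → u ≢ v
  adj⇒≢ {u = u} uv refl = contradiction (trans (sym uv) (adj-irr G u)) λ ()

  ∈N⁺ : adj G v w ≡ true → w ∈ N G v
  ∈N⁺ {v = v} {w = w} vw =
    lookup⇒[]= w (N G v) (trans (lookup∘tabulate _ w) (cong (λ b → if b then inside else outside) vw))

  ∈N⁻ : w ∈ N G v → adj G v w ≡ true
  ∈N⁻ {w = w} {v = v} w∈ = if-true⁻ (adj G v w) (trans (sym (lookup∘tabulate _ w)) ([]=⇒lookup w∈))
    where
    if-true⁻ : ∀ b → (if b then inside else outside) ≡ inside → b ≡ true
    if-true⁻ true _ = refl

  force-cannot-enter-fort : Fort G F → u ∉ F → adj G u w ≡ true →
                            (∀ v → adj G u v ≡ true → v ≢ w → v ∉ F) → w ∉ F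
  force-cannot-enter-fort {F = F} {u = u} {w = w} (_ , fort) u∉F uw others w∈F =
    fort u u∉F (trans (cong ∣_∣ F∩Nu≡⁅w⁆) (∣⁅x⁆∣≡1 w))
    where
    F∩Nu⊆⁅w⁆ : F ∩ N G u ⊆ ⁅ w ⁆
    F∩Nu⊆⁅w⁆ {y} y∈ with x∈p∩q⁻ F (N G u) y∈ | y Fin.≟ w
    ... | _         , _   | yes refl = x∈⁅x⁆ w
    ... | y∈F , y∈N | no  y≢w  = contradiction y∈F (others y (∈N⁻ y∈N) y≢w)

    F∩Nu≡⁅w⁆ : F ∩ N G u ≡ ⁅ w ⁆
    F∩Nu≡⁅w⁆ = ⊆-antisym F∩Nu⊆⁅w⁆ λ y∈⁅w⁆ →
      subst (_∈ F ∩ N G u) (sym (x∈⁅y⁆⇒x≡y w y∈⁅w⁆)) (x∈p∩q⁺ (w∈F , ∈N⁺ uw))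

  force-preserves-disjointness : Fort G F → Force G B B′ →
                                 (∀ {x} → x ∈ B → x ∉ F) → (∀ {x} → x ∈ B′ → x ∉ F)
  force-preserves-disjointness {B = B} fort (force u w u∈B _ uw others) B∩F≡∅ x∈ with x∈p∪q⁻ B ⁅ w ⁆ x∈
  ... | inj₁ x∈B   = B∩F≡∅ x∈B
  ... | inj₂ x∈⁅w⁆ rewrite x∈⁅y⁆⇒x≡y w x∈⁅w⁆ =
    force-cannot-enter-fort fort (B∩F≡∅ u∈B) uw λ v uv v≢w → B∩F≡∅ (others v uv v≢w)

  zfs-meets-fort : Fort G F → ZFS G B → ¬ (∀ {x} → x ∈ B → x ∉ F)
  zfs-meets-fort ((x , x∈F) , _) ε              ⊤∩F≡∅ = ⊤∩F≡∅ ∈⊤ x∈F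
  zfs-meets-fort fort            (step ◅ steps) B∩F≡∅ =
    zfs-meets-fort fort steps (force-preserves-disjointness fort step B∩F≡∅)

  zir-⊆-zfs : ZIrSet G S → ZFS G B → B ⊆ S → S ⊆ B
  zir-⊆-zfs {B = B} zir zfs B⊆S {x} x∈S with x ∈? B
  ... | yes x∈B = x∈B
  ... | no  x∉B with zir x x∈S
  ...   | F , fort , S∩F≡⁅x⁆ = ⊥-elim (zfs-meets-fort fort zfs B∩F≡∅)
    where
    B∩F≡∅ : ∀ {y} → y ∈ B → y ∉ F
    B∩F≡∅ {y} y∈B y∈F =
      x∉B (subst (_∈ B) (x∈⁅y⁆⇒x≡y x (subst (y ∈_) S∩F≡⁅x⁆ (x∈p∩q⁺ (B⊆S y∈B , y∈F)))) y∈B)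

  minimal-zfs-⊆ : MinimalZFS G B → ZFS G B′ → B′ ⊆ B → B ⊆ B′
  minimal-zfs-⊆ {B′ = B′} (_ , minimal) zfs B′⊆B {x} x∈B with x ∈? B′
  ... | yes x∈B′ = x∈B′
  ... | no  x∉B′ = contradiction zfs (minimal B′ (B′⊆B , x , x∈B , x∉B′))

  -- Unlike a Force step, w may already be in B.
  zfs-by-force : u ∈ B → adj G u w ≡ true → (∀ v → adj G u v ≡ true → v ≢ w → v ∈ B) →
                 ZFS G (B ∪ ⁅ w ⁆) → ZFS G B
  zfs-by-force {u = u} {B = B} {w = w} u∈B uw others zfs with w ∈? B
  ... | yes w∈B = subst (ZFS G) (x∈p⇒p∪⁅x⁆≡p w∈B) zfs
  ... | no  w∉B = force u w u∈B w∉B uw others ◅ zfs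

  independent⇒privateFort : HasTwoNeighbours G → x ∈ S → Independent G (S - x) →
                            PrivateFort G S x (∁ (S - x))
  independent⇒privateFort {x = x} {S = S} two x∈S ind =
    ((x , x∉p⇒x∈∁p (x∉p-x S x)) , fort) , ⊆-antisym S∩F⊆⁅x⁆ ⁅x⁆⊆S∩F
    where
    neighbour∈F : ∀ {v a} → v ∈ S - x → adj G v a ≡ true → a ∈ ∁ (S - x)
    neighbour∈F v∈ va = x∉p⇒x∈∁p λ a∈ → ind v∈ a∈ va

    fort : ∀ v → v ∉ ∁ (S - x) → ∣ ∁ (S - x) ∩ N G v ∣ ≢ 1
    fort v v∉F with x∉∁p⇒x∈p v∉F | two v
    ... | v∈ | a , b , a≢b , va , vb = λ ∣∣≡1 → 1+n≰n (subst (2 ≤_) ∣∣≡1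
      (x∈p∧y∈p∧x≢y⇒2≤∣p∣ (x∈p∩q⁺ (neighbour∈F v∈ va , ∈N⁺ va))
                          (x∈p∩q⁺ (neighbour∈F v∈ vb , ∈N⁺ vb)) a≢b))

    S∩F⊆⁅x⁆ : S ∩ ∁ (S - x) ⊆ ⁅ x ⁆
    S∩F⊆⁅x⁆ {y} y∈ with x∈p∩q⁻ S _ y∈ | y Fin.≟ x
    ... | _ , _     | yes refl = x∈⁅x⁆ x
    ... | y∈S , y∈F | no  y≢x  = contradiction (x∈p∧x≢y⇒x∈p-y y∈S y≢x) (x∈∁p⇒x∉p y∈F)

    ⁅x⁆⊆S∩F : ⁅ x ⁆ ⊆ S ∩ ∁ (S - x)
    ⁅x⁆⊆S∩F y∈⁅x⁆ rewrite x∈⁅y⁆⇒x≡y x y∈⁅x⁆ = x∈p∩q⁺ (x∈S , x∉p⇒x∈∁p (x∉p-x S x))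

  independent⇒zir : HasTwoNeighbours G → Independent G S → ZIrSet G S
  independent⇒zir {S = S} two ind x x∈S =
    _ , independent⇒privateFort two x∈S λ u∈ v∈ → ind (p─q⊆p S _ u∈) (p─q⊆p S _ v∈)

  ∣S∣≤2⇒zir : HasTwoNeighbours G → ∣ S ∣ ≤ 2 → ZIrSet G S
  ∣S∣≤2⇒zir {S = S} two ∣S∣≤2 x x∈S = _ , independent⇒privateFort two x∈S λ u∈ v∈ uv →
    adj⇒≢ uv (∣p∣<2⇒x≡y (<-≤-trans (x∈p⇒∣p-x∣<∣p∣ x∈S) ∣S∣≤2) u∈ v∈)

zfs-contains-edge : {G : Graph (suc n)} → HasTwoNeighbours G → ZFS G B →
                    ∃₂ λ u v → u ∈ B × v ∈ B × adj G u v ≡ true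
zfs-contains-edge two ε with two zero
... | a , _ , _ , 0a , _ = zero , a , ∈⊤ , ∈⊤ , 0a
zfs-contains-edge two (force u w u∈B _ _ others ◅ _) with two u
... | a , b , a≢b , ua , ub with a Fin.≟ w
...   | yes refl = u , b , u∈B , others b ub (a≢b ∘ sym) , ub
...   | no  a≢w  = u , a , u∈B , others a ua a≢w , ua

visited : (ℕ → Fin n) → ℕ → Subset n
visited w zero    = ⁅ w zero ⁆
visited w (suc k) = visited w k ∪ ⁅ w (suc k) ⁆

∈-visited : ∀ (w : ℕ → Fin n) {j k} → j ≤ k → w j ∈ visited w k
∈-visited w {k = zero}  z≤n   = x∈⁅x⁆ (w zero)
∈-visited w {k = suc k} j≤1+k with m≤n⇒m<n∨m≡n j≤1+k
... | inj₁ j<1+k = p⊆p∪q _ (∈-visited w (s≤s⁻¹ j<1+k))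
... | inj₂ refl  = x∈p∪q⁺ (inj₂ (x∈⁅x⁆ (w (suc k))))

zfs-along-walk : ∀ {G : Graph n} (w : ℕ → Fin n) K →
                 (∀ k → adj G (w (suc k)) (w (suc (suc k))) ≡ true) →
                 (∀ k v → adj G (w (suc k)) v ≡ true → v ≡ w k ⊎ v ≡ w (suc (suc k))) →
                 (∀ v → ∃ λ k → k ≤ K × w k ≡ v) →
                 ZFS G (⁅ w 0 ⁆ ∪ ⁅ w 1 ⁆)
zfs-along-walk {G = G} w K adjacent only-neighbours covers = shrink K 0 (subst (ZFS G) (sym visited≡⊤) ε)
  where
  shrink-one : ∀ k → ZFS G (visited w (suc (suc k))) → ZFS G (visited w (suc k))
  shrink-one k = zfs-by-force (x∈p∪q⁺ (inj₂ (x∈⁅x⁆ (w (suc k))))) (adjacent k) others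
    where
    others : ∀ v → adj G (w (suc k)) v ≡ true → v ≢ w (suc (suc k)) → v ∈ visited w (suc k)
    others v wv v≢ with only-neighbours k v wv
    ... | inj₁ refl = ∈-visited w (n≤1+n k)
    ... | inj₂ v≡   = contradiction v≡ v≢

  shrink : ∀ d k → ZFS G (visited w (d + suc k)) → ZFS G (visited w (suc k))
  shrink zero    k zfs = zfs
  shrink (suc d) k zfs =
    shrink-one k (shrink d (suc k) (subst (ZFS G ∘ visited w) (sym (+-suc d (suc k))) zfs))

  visited≡⊤ : visited w (K + 1) ≡ ⊤
  visited≡⊤ = ⊆-antisym ⊆⊤ λ {v} _ → case covers v of λ where
    (k , k≤K , refl) → ∈-visited w (≤-trans k≤K (m≤m+n K 1))

module EdgeZeroForcing {n} (G : Graph (suc n)) (two : HasTwoNeighbours G)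
                       (edge-zfs : ∀ {u v} → adj G u v ≡ true → ZFS G (⁅ u ⁆ ∪ ⁅ v ⁆)) where

  zfs⇒2≤∣B∣ : ZFS G B → 2 ≤ ∣ B ∣
  zfs⇒2≤∣B∣ zfs with zfs-contains-edge two zfs
  ... | u , v , u∈B , v∈B , uv = x∈p∧y∈p∧x≢y⇒2≤∣p∣ u∈B v∈B (adj⇒≢ {G = G} uv)

  zir∋edge⇒∣S∣≤2 : ZIrSet G S → u ∈ S → v ∈ S → adj G u v ≡ true → ∣ S ∣ ≤ 2
  zir∋edge⇒∣S∣≤2 {u = u} {v = v} zir u∈S v∈S uv = ≤-trans
    (p⊆q⇒∣p∣≤∣q∣ (zir-⊆-zfs zir (edge-zfs uv) (⁅x⁆∪⁅y⁆⊆p u∈S v∈S))) (∣⁅x⁆∪⁅y⁆∣≤2 u v)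

  zir∧2<∣S∣⇒independent : ZIrSet G S → 2 < ∣ S ∣ → Independent G S
  zir∧2<∣S∣⇒independent zir 2<∣S∣ u∈S v∈S uv = <⇒≱ 2<∣S∣ (zir∋edge⇒∣S∣≤2 zir u∈S v∈S uv)

  private
    a : Fin (suc n)
    a = proj₁ (two zero)

    0a : adj G zero a ≡ true
    0a = let (_ , _ , 0a , _) = proj₂ (two zero) in 0a

    E : Subset (suc n)
    E = ⁅ zero ⁆ ∪ ⁅ a ⁆

    ∣E∣≡2 : ∣ E ∣ ≡ 2
    ∣E∣≡2 = ∣⁅x⁆∪⁅y⁆∣≡2 (adj⇒≢ {G = G} 0a)

  Z≡2 : Zeq G 2
  Z≡2 = (E , edge-zfs 0a , ∣E∣≡2) , λ _ → zfs⇒2≤∣B∣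

  Zbar≡2 : Zbareq G 2
  Zbar≡2 = (E , (edge-zfs 0a , E-minimal) , ∣E∣≡2) , minimal-size
    where
    E-minimal : ∀ B → B ⊂ E → ¬ ZFS G B
    E-minimal B B⊂E zfs = <⇒≱ (subst (∣ B ∣ <_) ∣E∣≡2 (p⊂q⇒∣p∣<∣q∣ B⊂E)) (zfs⇒2≤∣B∣ zfs)

    minimal-size : ∀ B → MinimalZFS G B → ∣ B ∣ ≤ 2
    minimal-size B minimal with zfs-contains-edge two (proj₁ minimal)
    ... | u , v , u∈B , v∈B , uv = ≤-trans
      (p⊆q⇒∣p∣≤∣q∣ (minimal-zfs-⊆ minimal (edge-zfs uv) (⁅x⁆∪⁅y⁆⊆p u∈B v∈B))) (∣⁅x⁆∪⁅y⁆∣≤2 u v)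

  zir≡2 : zireq G 2
  zir≡2 = (E , (∣S∣≤2⇒zir {G = G} two (≤-reflexive ∣E∣≡2) , E-maximal) , ∣E∣≡2) , maximal-size
    where
    E-maximal : ∀ T → E ⊂ T → ¬ ZIrSet G T
    E-maximal T E⊂T@(E⊆T , _) zir = <⇒≱ (subst (_< ∣ T ∣) ∣E∣≡2 (p⊂q⇒∣p∣<∣q∣ E⊂T))
      (zir∋edge⇒∣S∣≤2 zir (E⊆T (x∈p∪q⁺ (inj₁ (x∈⁅x⁆ zero)))) (E⊆T (x∈p∪q⁺ (inj₂ (x∈⁅x⁆ a)))) 0a)

    maximal-size : ∀ S → MaximalZIrSet G S → 2 ≤ ∣ S ∣
    maximal-size S (_ , maximal) with 2 ≤? ∣ S ∣
    ... | yes 2≤∣S∣ = 2≤∣S∣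
    ... | no  2≰∣S∣ with ∣p∣<2∧x≢y⇒∃∉ (≰⇒> 2≰∣S∣) (adj⇒≢ {G = G} 0a)
    ...   | v , v∉S = ⊥-elim (maximal (S ∪ ⁅ v ⁆) (p⊆p∪q ⁅ v ⁆ , v , x∈p∪q⁺ (inj₂ (x∈⁅x⁆ v)) , v∉S)
                        (∣S∣≤2⇒zir {G = G} two (≤-trans (∣p∪q∣≤∣p∣+∣q∣ S ⁅ v ⁆)
                          (+-mono-≤ (s≤s⁻¹ (≰⇒> 2≰∣S∣)) (≤-reflexive (∣⁅x⁆∣≡1 v))))))

-- The cycle

∨-true⁻ : ∀ {a b} → a ∨ b ≡ true → a ≡ true ⊎ b ≡ true
∨-true⁻ {true}  _   = inj₁ refl
∨-true⁻ {false} b≡t = inj₂ b≡t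

⌊⌋-∨-∧⁻ : ∀ {A B C : Set} (a? : Dec A) (b? : Dec B) (c? : Dec C) →
          ⌊ a? ⌋ ∨ (⌊ b? ⌋ ∧ ⌊ c? ⌋) ≡ true → A ⊎ B × C
⌊⌋-∨-∧⁻ (yes a) _       _       _  = inj₁ a
⌊⌋-∨-∧⁻ (no _)  (yes b) (yes c) _  = inj₂ (b , c)
⌊⌋-∨-∧⁻ (no _)  (yes _) (no _)  ()
⌊⌋-∨-∧⁻ (no _)  (no _)  _       ()

⌊⌋-∨-∧⁺ : ∀ {A B C : Set} (a? : Dec A) (b? : Dec B) (c? : Dec C) →
          A ⊎ B × C → ⌊ a? ⌋ ∨ (⌊ b? ⌋ ∧ ⌊ c? ⌋) ≡ true
⌊⌋-∨-∧⁺ (yes _) _       _       _              = refl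
⌊⌋-∨-∧⁺ (no ¬a) _       _       (inj₁ a)       = contradiction a ¬a
⌊⌋-∨-∧⁺ (no _)  (yes _) (yes _) (inj₂ _)       = refl
⌊⌋-∨-∧⁺ (no _)  (no ¬b) _       (inj₂ (b , _)) = contradiction b ¬b
⌊⌋-∨-∧⁺ (no _)  (yes _) (no ¬c) (inj₂ (_ , c)) = contradiction c ¬c

next : Fin (suc m) → Fin (suc m)
next {m} i with toℕ i <? m
... | yes i<m = suc (fromℕ< i<m)
... | no  _   = zero

next-< : ∀ (i : Fin (suc m)) (i<m : toℕ i < m) → next i ≡ suc (fromℕ< i<m)
next-< {m} i i<m with toℕ i <? m
... | yes _   = refl
... | no  i≮m = contradiction i<m i≮m

next-last : ∀ (i : Fin (suc m)) → toℕ i ≡ m → next i ≡ zero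
next-last {m} i i≡m with toℕ i <? m
... | yes i<m = contradiction (subst (_< m) i≡m i<m) (<-irrefl refl)
... | no  _   = refl

last-or-not : ∀ (i : Fin (suc m)) → toℕ i < m ⊎ toℕ i ≡ m
last-or-not i = m≤n⇒m<n∨m≡n (toℕ≤pred[n] i)

toℕ-next : ∀ (i : Fin (suc m)) → toℕ i < m → toℕ (next i) ≡ suc (toℕ i)
toℕ-next i i<m = trans (cong toℕ (next-< i i<m)) (cong suc (toℕ-fromℕ< i<m))

toℕ≡suc⇒≡next : ∀ {i j : Fin (suc m)} → toℕ j ≡ suc (toℕ i) → j ≡ next i
toℕ≡suc⇒≡next {i = i} {j} j≡1+i = toℕ-injective (trans j≡1+i (sym (toℕ-next i i<m)))
  where i<m = subst (_≤ _) j≡1+i (toℕ≤pred[n] j)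

next-injective : ∀ {i j : Fin (suc m)} → next i ≡ next j → i ≡ j
next-injective {i = i} {j} eq with last-or-not i | last-or-not j
... | inj₁ i<m | inj₁ j<m = toℕ-injective (suc-injective (begin
  suc (toℕ i)    ≡⟨ toℕ-next i i<m ⟨
  toℕ (next i)   ≡⟨ cong toℕ eq ⟩
  toℕ (next j)   ≡⟨ toℕ-next j j<m ⟩
  suc (toℕ j)    ∎))
  where open ≡-Reasoning
... | inj₁ i<m | inj₂ j≡m =
  contradiction (trans (sym (toℕ-next i i<m)) (cong toℕ (trans eq (next-last j j≡m)))) λ ()
... | inj₂ i≡m | inj₁ j<m =
  contradiction (trans (sym (toℕ-next j j<m)) (cong toℕ (trans (sym eq) (next-last i i≡m)))) λ ()
... | inj₂ i≡m | inj₂ j≡m = toℕ-injective (trans i≡m (sym j≡m))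

walk : Fin (suc m) → ℕ → Fin (suc m)
walk u zero    = u
walk u (suc k) = next (walk u k)

toℕ-walk : ∀ (u : Fin (suc m)) k → toℕ u + k ≤ m → toℕ (walk u k) ≡ toℕ u + k
toℕ-walk u zero    _         = sym (+-identityʳ (toℕ u))
toℕ-walk {m} u (suc k) u+1+k≤m = begin
  toℕ (next (walk u k))  ≡⟨ toℕ-next (walk u k) (subst (_< m) (sym IH) u+k<m) ⟩
  suc (toℕ (walk u k))   ≡⟨ cong suc IH ⟩
  suc (toℕ u + k)        ≡⟨ +-suc (toℕ u) k ⟨
  toℕ u + suc k          ∎
  where
  open ≡-Reasoning
  u+k<m : toℕ u + k < m
  u+k<m = subst (_≤ m) (+-suc (toℕ u) k) u+1+k≤m
  IH : toℕ (walk u k) ≡ toℕ u + k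
  IH = toℕ-walk u k (<⇒≤ u+k<m)

walk-+ : ∀ (u : Fin (suc m)) j k → walk u (j + k) ≡ walk (walk u k) j
walk-+ u zero    k = refl
walk-+ u (suc j) k = cong next (walk-+ u j k)

walk-to-zero : ∀ (u : Fin (suc m)) → walk u (suc m ∸ toℕ u) ≡ zero
walk-to-zero {m} u = begin
  walk u (suc m ∸ toℕ u)     ≡⟨ cong (walk u) (+-∸-assoc 1 u≤m) ⟩
  next (walk u (m ∸ toℕ u))  ≡⟨ next-last _ (trans (toℕ-walk u _ (≤-reflexive u+d≡m)) u+d≡m) ⟩
  zero                       ∎
  where
  open ≡-Reasoning
  u≤m = toℕ≤pred[n] u
  u+d≡m = m+[n∸m]≡n u≤m

walk-reaches : ∀ (u v : Fin (suc m)) → walk u (toℕ v + (suc m ∸ toℕ u)) ≡ v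
walk-reaches {m} u v = begin
  walk u (toℕ v + (suc m ∸ toℕ u))       ≡⟨ walk-+ u (toℕ v) _ ⟩
  walk (walk u (suc m ∸ toℕ u)) (toℕ v)  ≡⟨ cong (λ x → walk x (toℕ v)) (walk-to-zero u) ⟩
  walk zero (toℕ v)                      ≡⟨ toℕ-injective (toℕ-walk zero (toℕ v) (toℕ≤pred[n] v)) ⟩
  v                                      ∎
  where open ≡-Reasoning

walk-period : ∀ (u : Fin (suc m)) → walk u (suc m) ≡ u
walk-period u = subst (λ k → walk u k ≡ u) (m+[n∸m]≡n (toℕ≤n u)) (walk-reaches u u)

-- Walks commute, so walk u 2 ≡ u would transport to walk zero 2 ≡ zero.
walk-2≢id : 3 ≤ suc m → ∀ (u : Fin (suc m)) → walk u 2 ≢ u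
walk-2≢id {m} 3≤n u walk²u≡u =
  contradiction (trans (sym (toℕ-walk zero 2 (s≤s⁻¹ 3≤n))) (cong toℕ walk²0≡0)) λ ()
  where
  open ≡-Reasoning
  d = suc m ∸ toℕ u
  walk²0≡0 : walk zero 2 ≡ zero
  walk²0≡0 = begin
    walk zero 2         ≡⟨ cong (λ x → walk x 2) (walk-to-zero u) ⟨
    walk (walk u d) 2   ≡⟨ walk-+ u 2 d ⟨
    walk u (2 + d)      ≡⟨ cong (walk u) (+-comm 2 d) ⟩
    walk u (d + 2)      ≡⟨ walk-+ u d 2 ⟩
    walk (walk u 2) d   ≡⟨ cong (λ x → walk x d) walk²u≡u ⟩
    walk u d            ≡⟨ walk-to-zero u ⟩
    zero                ∎

cycAdj₀⇒next : ∀ {i j : Fin (suc m)} → cycAdj₀ (suc m) i j ≡ true → j ≡ next i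
cycAdj₀⇒next {m} {i} {j} ij with ⌊⌋-∨-∧⁻ (toℕ j ≟ suc (toℕ i)) (toℕ i ≟ m) (toℕ j ≟ 0) ij
... | inj₁ j≡1+i        = toℕ≡suc⇒≡next j≡1+i
... | inj₂ (i≡m , j≡0) = trans (toℕ-injective j≡0) (sym (next-last i i≡m))

cycAdj₀-next : ∀ (i : Fin (suc m)) → cycAdj₀ (suc m) i (next i) ≡ true
cycAdj₀-next {m} i = ⌊⌋-∨-∧⁺ (toℕ (next i) ≟ suc (toℕ i)) (toℕ i ≟ m) (toℕ (next i) ≟ 0)
  (Sum.map (toℕ-next i) (λ i≡m → i≡m , cong toℕ (next-last i i≡m)) (last-or-not i))

cycAdj⇒next : ∀ (u v : Fin (suc m)) → cycAdj (suc m) u v ≡ true → v ≡ next u ⊎ u ≡ next v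
cycAdj⇒next _ _ uv = Sum.map cycAdj₀⇒next cycAdj₀⇒next (∨-true⁻ uv)

cycAdj-next : ∀ (u : Fin (suc m)) → cycAdj (suc m) u (next u) ≡ true
cycAdj-next {m} u = cong (_∨ cycAdj₀ (suc m) (next u) u) (cycAdj₀-next u)

rotate : Vec A (suc m) → Vec A (suc m)
rotate (x ∷ xs) = xs ∷ʳ x

lookup-∷ʳ-< : ∀ (xs : Vec A m) x (i : Fin (suc m)) (i<m : toℕ i < m) →
              lookup (xs ∷ʳ x) i ≡ lookup xs (fromℕ< i<m)
lookup-∷ʳ-< (_ ∷ _)  _ zero    _         = refl
lookup-∷ʳ-< (_ ∷ xs) x (suc i) (s≤s i<m) = lookup-∷ʳ-< xs x i i<m

lookup-∷ʳ-last : ∀ (xs : Vec A m) x (i : Fin (suc m)) → toℕ i ≡ m → lookup (xs ∷ʳ x) i ≡ x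
lookup-∷ʳ-last []       _ zero    _   = refl
lookup-∷ʳ-last (_ ∷ xs) x (suc i) i≡m = lookup-∷ʳ-last xs x i (suc-injective i≡m)

lookup-rotate : ∀ (xs : Vec A (suc m)) i → lookup (rotate xs) i ≡ lookup xs (next i)
lookup-rotate (x ∷ xs) i with last-or-not i
... | inj₁ i<m rewrite next-< i i<m = lookup-∷ʳ-< xs x i i<m
... | inj₂ i≡m rewrite next-last i i≡m = lookup-∷ʳ-last xs x i i≡m

∣p∷ʳx∣≡∣x∷p∣ : ∀ x (p : Subset n) → ∣ p ∷ʳ x ∣ ≡ ∣ x ∷ p ∣
∣p∷ʳx∣≡∣x∷p∣ _       []            = refl
∣p∷ʳx∣≡∣x∷p∣ outside (outside ∷ p) = ∣p∷ʳx∣≡∣x∷p∣ outside p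
∣p∷ʳx∣≡∣x∷p∣ inside  (outside ∷ p) = ∣p∷ʳx∣≡∣x∷p∣ inside p
∣p∷ʳx∣≡∣x∷p∣ outside (inside ∷ p)  = cong suc (∣p∷ʳx∣≡∣x∷p∣ outside p)
∣p∷ʳx∣≡∣x∷p∣ inside  (inside ∷ p)  = cong suc (∣p∷ʳx∣≡∣x∷p∣ inside p)

∣rotate∣ : ∀ (p : Subset (suc m)) → ∣ rotate p ∣ ≡ ∣ p ∣
∣rotate∣ (x ∷ p) = ∣p∷ʳx∣≡∣x∷p∣ x p

⌊n/2⌋≡n/2 : ∀ n → ⌊ n /2⌋ ≡ n / 2
⌊n/2⌋≡n/2 zero          = refl
⌊n/2⌋≡n/2 (suc zero)    = refl
⌊n/2⌋≡n/2 (suc (suc n)) =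
  trans (cong suc (⌊n/2⌋≡n/2 n)) (sym (m/n≡1+[m∸n]/n {suc (suc n)} {2} (s≤s (s≤s z≤n))))

alternating : ∀ k → Subset k
alternating zero          = []
alternating (suc zero)    = outside ∷ []
alternating (suc (suc k)) = inside ∷ outside ∷ alternating k

∣alternating∣ : ∀ k → ∣ alternating k ∣ ≡ ⌊ k /2⌋
∣alternating∣ zero          = refl
∣alternating∣ (suc zero)    = refl
∣alternating∣ (suc (suc k)) = cong suc (∣alternating∣ k)

zero∈alternating : ∀ {k} → 2 ≤ suc k → zero ∈ alternating (suc k)
zero∈alternating {suc k} _               = here
zero∈alternating {zero}  (s≤s ())

alternating-∈⇒< : ∀ {k} {i : Fin k} → i ∈ alternating k → suc (toℕ i) < k
alternating-∈⇒< {suc zero}    (there ())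
alternating-∈⇒< {suc (suc k)} here               = s≤s (s≤s z≤n)
alternating-∈⇒< {suc (suc k)} (there (there i∈)) = s≤s (s≤s (alternating-∈⇒< i∈))

alternating-sparse : ∀ {k} {i j : Fin k} → i ∈ alternating k → j ∈ alternating k → toℕ j ≢ suc (toℕ i)
alternating-sparse {suc (suc k)} (there (there i∈)) (there (there j∈)) j≡1+i =
  alternating-sparse i∈ j∈ (suc-injective (suc-injective j≡1+i))
alternating-sparse {suc (suc k)} here               (there (there _)) ()
alternating-sparse {suc (suc k)} (there (there _))  here              ()

alternating-∉ : ∀ {k} (i : Fin k) → i ∉ alternating k →
                suc (toℕ i) ≡ k ⊎ ∃ λ j → j ∈ alternating k × toℕ i ≡ suc (toℕ j)
alternating-∉ {suc zero}    zero          _   = inj₁ refl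
alternating-∉ {suc (suc k)} zero          i∉ = contradiction here i∉
alternating-∉ {suc (suc k)} (suc zero)    _   = inj₂ (zero , here , refl)
alternating-∉ {suc (suc k)} (suc (suc i)) i∉ with alternating-∉ i (i∉ ∘ there ∘ there)
... | inj₁ 1+i≡k            = inj₁ (cong (λ k → suc (suc k)) 1+i≡k)
... | inj₂ (j , j∈ , i≡1+j) = inj₂ (suc (suc j) , there (there j∈) , cong (λ k → suc (suc k)) i≡1+j)

module CycleGraph {m} (3≤n : 3 ≤ suc m) where

  C : Graph (suc m)
  C = Cycle (suc m) 3≤n

  two-neighbours : HasTwoNeighbours C
  two-neighbours u = next u , walk u m , next≢prev , cycAdj-next u , prev-adj
    where
    prev-adj : cycAdj (suc m) u (walk u m) ≡ true
    prev-adj = subst (λ x → cycAdj (suc m) x (walk u m) ≡ true) (walk-period u)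
      (trans (adj-sym C (next (walk u m)) (walk u m)) (cycAdj-next (walk u m)))

    next≢prev : next u ≢ walk u m
    next≢prev eq = walk-2≢id 3≤n u (trans (cong next eq) (walk-period u))

  arc-zfs : ∀ u → ZFS C (⁅ u ⁆ ∪ ⁅ next u ⁆)
  arc-zfs u =
    zfs-along-walk (walk u) (suc m + suc m) (λ k → cycAdj-next (walk u (suc k))) neighbours covers
    where
    neighbours : ∀ k v → adj C (walk u (suc k)) v ≡ true → v ≡ walk u k ⊎ v ≡ walk u (suc (suc k))
    neighbours k v wv with cycAdj⇒next (walk u (suc k)) v wv
    ... | inj₁ v≡next = inj₂ v≡next
    ... | inj₂ next≡  = inj₁ (next-injective (sym next≡))

    covers : ∀ v → ∃ λ k → k ≤ suc m + suc m × walk u k ≡ v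
    covers v = _ , +-mono-≤ (toℕ≤n v) (m∸n≤m (suc m) (toℕ u)) , walk-reaches u v

  edge-zfs : ∀ {u v} → adj C u v ≡ true → ZFS C (⁅ u ⁆ ∪ ⁅ v ⁆)
  edge-zfs {u} {v} uv with cycAdj⇒next u v uv
  ... | inj₁ refl = arc-zfs _
  ... | inj₂ refl = subst (ZFS C) (∪-comm _ _) (arc-zfs _)

  open EdgeZeroForcing C two-neighbours edge-zfs public

  -- next maps S into its complement, and rotate S is the preimage of S under next.
  independent⇒∣S∣≤n/2 : Independent C S → ∣ S ∣ ≤ suc m / 2
  independent⇒∣S∣≤n/2 {S = S} independent = begin
    ∣ S ∣                 ≡⟨ n≡⌊n+n/2⌋ ∣ S ∣ ⟩
    ⌊ ∣ S ∣ + ∣ S ∣ /2⌋   ≤⟨ ⌊n/2⌋-mono (m≤o∸n⇒m+n≤o ∣ S ∣ (∣p∣≤n S) ∣S∣≤n∸∣S∣) ⟩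
    ⌊ suc m /2⌋           ≡⟨ ⌊n/2⌋≡n/2 (suc m) ⟩
    suc m / 2             ∎
    where
    open ≤-Reasoning
    S⊆∁rotateS : S ⊆ ∁ (rotate S)
    S⊆∁rotateS {i} i∈S = x∉p⇒x∈∁p λ i∈rotateS → independent i∈S
      (lookup⇒[]= (next i) S (trans (sym (lookup-rotate S i)) ([]=⇒lookup i∈rotateS))) (cycAdj-next i)

    ∣S∣≤n∸∣S∣ : ∣ S ∣ ≤ suc m ∸ ∣ S ∣
    ∣S∣≤n∸∣S∣ = begin
      ∣ S ∣                ≤⟨ p⊆q⇒∣p∣≤∣q∣ S⊆∁rotateS ⟩
      ∣ ∁ (rotate S) ∣     ≡⟨ ∣∁p∣≡n∸∣p∣ (rotate S) ⟩
      suc m ∸ ∣ rotate S ∣ ≡⟨ cong (suc m ∸_) (∣rotate∣ S) ⟩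
      suc m ∸ ∣ S ∣        ∎

  next∉alternating : ∀ {i} → i ∈ alternating (suc m) → next i ∉ alternating (suc m)
  next∉alternating {i} i∈ next∈ = alternating-sparse i∈ next∈ (toℕ-next i (s≤s⁻¹ (alternating-∈⇒< i∈)))

  alternating-independent : Independent C (alternating (suc m))
  alternating-independent {u} {v} u∈ v∈ uv with cycAdj⇒next u v uv
  ... | inj₁ refl = next∉alternating u∈ v∈
  ... | inj₂ refl = next∉alternating v∈ u∈

  alternating-dominating : ∀ {x} → x ∉ alternating (suc m) →
                           ∃ λ y → y ∈ alternating (suc m) × adj C x y ≡ true
  alternating-dominating {x} x∉ with alternating-∉ x x∉
  ... | inj₁ 1+x≡n = zero , zero∈alternating (≤-trans (n≤1+n 2) 3≤n) ,
    subst (λ y → cycAdj (suc m) x y ≡ true) (next-last x (suc-injective 1+x≡n)) (cycAdj-next x)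
  ... | inj₂ (j , j∈ , x≡1+j) = j , j∈ ,
    subst (λ y → cycAdj (suc m) y j ≡ true) (sym (toℕ≡suc⇒≡next x≡1+j))
      (trans (adj-sym C (next j) j) (cycAdj-next j))

  ZIR≡n/2 : 4 ≤ suc m → ZIReq C (suc m / 2)
  ZIR≡n/2 4≤n =
    (alt , (independent⇒zir {G = C} two-neighbours alternating-independent , alt-maximal) , ∣alt∣≡n/2) ,
    maximal-size
    where
    alt = alternating (suc m)

    2≤n/2 : 2 ≤ suc m / 2
    2≤n/2 = /-monoˡ-≤ 2 4≤n

    ∣alt∣≡n/2 : ∣ alt ∣ ≡ suc m / 2
    ∣alt∣≡n/2 = trans (∣alternating∣ (suc m)) (⌊n/2⌋≡n/2 (suc m))

    alt-maximal : ∀ T → alt ⊂ T → ¬ ZIrSet C T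
    alt-maximal T alt⊂T@(alt⊆T , x , x∈T , x∉alt) zir with alternating-dominating x∉alt
    ... | y , y∈alt , xy = <⇒≱ (p⊂q⇒∣p∣<∣q∣ alt⊂T)
      (≤-trans (zir∋edge⇒∣S∣≤2 zir x∈T (alt⊆T y∈alt) xy) (subst (2 ≤_) (sym ∣alt∣≡n/2) 2≤n/2))

    maximal-size : ∀ S → MaximalZIrSet C S → ∣ S ∣ ≤ suc m / 2
    maximal-size S (zir , _) with ∣ S ∣ ≤? 2
    ... | yes ∣S∣≤2 = ≤-trans ∣S∣≤2 2≤n/2
    ... | no  ∣S∣≰2 = independent⇒∣S∣≤n/2 (zir∧2<∣S∣⇒independent zir (≰⇒> ∣S∣≰2))

proposition3p2 : (n : ℕ) → (h : 4 ≤ n) →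
    let C = Cycle n (≤-trans (n≤1+n 3) h) in
    zireq C 2 × Zeq C 2 × Zbareq C 2 × ZIReq C (n / 2)
proposition3p2 (suc m) 4≤n = zir≡2 , Z≡2 , Zbar≡2 , ZIR≡n/2 4≤n
  where open CycleGraph (≤-trans (n≤1+n 3) 4≤n)
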